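{- Let $\mathbf{HGr}$ be the category of finite hypergraphs and injective hypergraph homomorphisms, let $\Omega_n=([n],2^{[n]})$ for $n\in\mathbb{N}$, and let $\mathfrak{P}$ assign to each span $H_1\xleftarrow{h_1}\Omega_n\xrightarrow{h_2}H_2$ in $\mathbf{HGr}$ the cocone $H_1\to\mathfrak{P}(h_1,h_2)\leftarrow H_2$, where $\mathfrak{P}(h_1,h_2)$ has vertex set $(V(H_1)\uplus V(H_2))/_{h_1=h_2}$ (identify $h_1(v)$ with $h_2(v)$ for each $v\in[n]$) and edge set $(E(H_1)\uplus E(H_2))/_{h_1=h_2}$ (the images of the hyperedges of $H_1$ and $H_2$ in the quotient vertex set, coinciding images identified), and the maps send each vertex of $H_i$ to its class. Then $(\mathbf{HGr},\Omega,\mathfrak{P})$ is a spined category.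
   Context: $\mathbb{N}=\{0,1,\dots\}$, $[n]=\{1,\dots,n\}$. A hypergraph is $H=(V(H),E(H))$ with $V(H)$ finite and $E(H)$ a set of subsets of $V(H)$; a hypergraph homomorphism $h:H_1\to H_2$ is a map on vertices with $h(F)\in E(H_2)$ for all $F\in E(H_1)$. A spined category is a triple $(\mathcal{C},\Omega,\mathfrak{P})$: a category $\mathcal{C}$, a sequence of objects $(\Omega_n)_{n\in\mathbb{N}}$, and an operation $\mathfrak{P}$ assigning to each span $G\xleftarrow{g}\Omega_n\xrightarrow{h}H$ an object $\mathfrak{P}(g,h)$ and morphisms $\mathfrak{P}(g,h)_g:G\to\mathfrak{P}(g,h)$, $\mathfrak{P}(g,h)_h:H\to\mathfrak{P}(g,h)$ with $\mathfrak{P}(g,h)_gg=\mathfrak{P}(g,h)_hh$, such that (SC1) every object $X$ has a morphism $X\to\Omega_n$ for some $n$; (SC2) for every such span and all $g':G\to G'$, $h':H\to H'$ there is a unique morphism $(g',h'):\mathfrak{P}(g,h)\to\mathfrak{P}(g'g,h'h)$ with $(g',h')\mathfrak{P}(g,h)_g=\mathfrak{P}(g'g,h'h)_{g'g}g'$ and $(g',h')\mathfrak{P}(g,h)_h=\mathfrak{P}(g'g,h'h)_{h'h}h'$. -}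

module Defs where

open import Data.Nat using (ℕ; _+_)
open import Data.Fin using (Fin; splitAt; _↑ˡ_; _↑ʳ_)
open import Data.Fin.Properties using (any?; splitAt-↑ˡ; splitAt-↑ʳ)
import Data.Fin.Properties as FinP
open import Data.Bool using (Bool; true; false; not; T)
open import Data.Bool.Properties using (T-irrelevant)
open import Data.Unit using (⊤; tt)
open import Data.Empty using (⊥-elim)
open import Data.Sum using (_⊎_; inj₁; inj₂; [_,_])
import Data.Sum.Properties as SumP
import Data.Product.Properties as ProdP
open import Data.Product using (Σ; ∃; ∃-syntax; _×_; _,_; proj₁; proj₂)
open import Function using (_∘_)
open import Function.Bundles using (_⇔_; mk⇔; Equivalence)
open import Function.Definitions using (Injective)
open import Relation.Nullary using (Dec; yes; no; ¬_)
open import Relation.Nullary.Decidable using (⌊_⌋)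
open import Relation.Binary.Definitions using (DecidableEquality)
open import Relation.Binary.PropositionalEquality using (_≡_; refl; sym; trans; cong)

-- The vertex set is a finite type V (a surjection from some Fin size,
-- with decidable equality).
-- E is the family of (representatives of) hyperedges; a subset G of V
-- "is" the edge F when they have the same members (see IsImage below),
-- so all statements about edges are invariant under extensional equality.

record Hypergraph : Set₁ where
  field
    V         : Set
    size      : ℕ
    enum      : Fin size → V
    enum-surj : ∀ v → ∃[ i ] enum i ≡ v
    _≟V_      : DecidableEquality V
    E         : (V → Bool) → Set

open Hypergraph public

IsImage : {A B : Set} → (A → B) → (A → Bool) → (B → Bool) → Set
IsImage {A} f F G = ∀ w → T (G w) ⇔ (∃[ v ] (T (F v) × f v ≡ w))

Preserves : (H K : Hypergraph) → (V H → V K) → Set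
Preserves H K f = ∀ F → E H F → ∃[ G ] (E K G × IsImage f F G)

IsHom : (H K : Hypergraph) → (V H → V K) → Set
IsHom H K f = Injective _≡_ _≡_ f × Preserves H K f

record Hom (H K : Hypergraph) : Set where
  constructor hom
  field
    fun   : V H → V K
    isHom : IsHom H K fun

open Hom public

infixr 9 _∘H_
_∘H_ : {H K L : Hypergraph} → Hom K L → Hom H K → Hom H L
_∘H_ {H} {K} {L} (hom g (gi , gp)) (hom f (fi , fp)) =
  hom (g ∘ f) ((λ e → fi (gi e)) , pres)
  where
  pres : Preserves H L (g ∘ f)
  pres F eF with fp F eF
  ... | G , eG , imG with gp G eG
  ...   | G' , eG' , imG' = G' , eG' , λ w → mk⇔ (to w) (from w)
    where
    to : ∀ w → T (G' w) → ∃[ v ] (T (F v) × g (f v) ≡ w)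
    to w t with Equivalence.to (imG' w) t
    ... | u , tu , gu≡w with Equivalence.to (imG u) tu
    ...   | v , tv , fv≡u = v , tv , trans (cong g fv≡u) gu≡w
    from : ∀ w → ∃[ v ] (T (F v) × g (f v) ≡ w) → T (G' w)
    from w (v , tv , eq) =
      Equivalence.from (imG' w) (f v , Equivalence.from (imG (f v)) (v , tv , refl) , eq)

Ω : ℕ → Hypergraph
Ω n = record
  { V = Fin n ; size = n ; enum = λ i → i ; enum-surj = λ v → v , refl
  ; _≟V_ = FinP._≟_ ; E = λ _ → ⊤ }

-- Vertex set: (V(G) ⊎ V(H)) / (h₁ v ~ h₂ v), represented by a system of
-- canonical representatives: all inj₁ x, and those inj₂ y with y not in
-- the image of h₂ (an element inj₂ (h₂ v) is represented by inj₁ (h₁ v)).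

module Gluing {n : ℕ} (G H : Hypergraph) (h₁ : Fin n → V G) (h₂ : Fin n → V H) where

  inIm₂ : (y : V H) → Dec (∃[ i ] h₂ i ≡ y)
  inIm₂ y = any? (λ i → (H ≟V h₂ i) y)

  canon : V G ⊎ V H → Bool
  canon (inj₁ _) = true
  canon (inj₂ y) = not ⌊ inIm₂ y ⌋

  PV : Set
  PV = Σ (V G ⊎ V H) (T ∘ canon)

  private
    notT : {A : Set} (d : Dec A) → ¬ A → T (not ⌊ d ⌋)
    notT (yes a) ¬a = ⊥-elim (¬a a)
    notT (no _)  _  = tt

    cls₂ : (y : V H) → Dec (∃[ i ] h₂ i ≡ y) → PV
    cls₂ y (yes (i , _)) = inj₁ (h₁ i) , tt
    cls₂ y (no ¬p)       = inj₂ y , notT (inIm₂ y) ¬p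

  cls : V G ⊎ V H → PV
  cls (inj₁ x) = inj₁ x , tt
  cls (inj₂ y) = cls₂ y (inIm₂ y)

  ι₁ : V G → PV
  ι₁ x = cls (inj₁ x)

  ι₂ : V H → PV
  ι₂ y = cls (inj₂ y)

  private
    cls-canon : ∀ (p : PV) → ∃[ z ] cls z ≡ p
    cls-canon (inj₁ x , tt) = inj₁ x , refl
    cls-canon (inj₂ y , t) = inj₂ y , aux (inIm₂ y) t t
      where
      aux : (d : Dec (∃[ i ] h₂ i ≡ y)) → T (not ⌊ d ⌋) →
            (t : T (not ⌊ inIm₂ y ⌋)) → cls₂ y d ≡ (inj₂ y , t)
      aux (yes _) () _
      aux (no ¬p) _ t = cong (inj₂ y ,_) (T-irrelevant _ _)

    joinE : Fin (size G + size H) → V G ⊎ V H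
    joinE i = [ (λ a → inj₁ (enum G a)) , (λ b → inj₂ (enum H b)) ] (splitAt (size G) i)

    joinE-surj : ∀ z → ∃[ i ] joinE i ≡ z
    joinE-surj (inj₁ x) with enum-surj G x
    ... | a , refl = (a ↑ˡ size H) , cong [ _ , _ ] (splitAt-↑ˡ (size G) a (size H))
    joinE-surj (inj₂ y) with enum-surj H y
    ... | b , refl = (size G ↑ʳ b) , cong [ _ , _ ] (splitAt-↑ʳ (size G) (size H) b)

    enumP : Fin (size G + size H) → PV
    enumP = cls ∘ joinE

    enumP-surj : ∀ p → ∃[ i ] enumP i ≡ p
    enumP-surj p with cls-canon p
    ... | z , eq with joinE-surj z
    ...   | i , refl = i , eq

    decP : DecidableEquality PV
    decP = ProdP.≡-dec (SumP.≡-dec (G ≟V_) (H ≟V_)) (λ s t → yes (T-irrelevant s t))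

  PE : (PV → Bool) → Set
  PE S = (∃[ F ] (E G F × IsImage ι₁ F S)) ⊎ (∃[ F ] (E H F × IsImage ι₂ F S))

  𝔓 : Hypergraph
  𝔓 = record
    { V = PV ; size = size G + size H ; enum = enumP ; enum-surj = enumP-surj
    ; _≟V_ = decP ; E = PE }

𝔓 : {n : ℕ} {G H : Hypergraph} → Hom (Ω n) G → Hom (Ω n) H → Hypergraph
𝔓 {G = G} {H} g h = Gluing.𝔓 G H (fun g) (fun h)

𝔓₁ : {n : ℕ} {G H : Hypergraph} (g : Hom (Ω n) G) (h : Hom (Ω n) H) → V G → V (𝔓 g h)
𝔓₁ {G = G} {H} g h = Gluing.ι₁ G H (fun g) (fun h)

𝔓₂ : {n : ℕ} {G H : Hypergraph} (g : Hom (Ω n) G) (h : Hom (Ω n) H) → V H → V (𝔓 g h)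
𝔓₂ {G = G} {H} g h = Gluing.ι₂ G H (fun g) (fun h)

𝔓-cocone : Set₁
𝔓-cocone = ∀ {n} {G H : Hypergraph} (g : Hom (Ω n) G) (h : Hom (Ω n) H) →
  IsHom G (𝔓 g h) (𝔓₁ g h) × IsHom H (𝔓 g h) (𝔓₂ g h) ×
  (∀ i → 𝔓₁ g h (fun g i) ≡ 𝔓₂ g h (fun h i))

SC1 : Set₁
SC1 = ∀ (X : Hypergraph) → ∃[ n ] Hom X (Ω n)

-- (SC2): unique existence, morphisms compared by their vertex maps
SC2 : Set₁
SC2 = ∀ {n} {G H G' H' : Hypergraph} (g : Hom (Ω n) G) (h : Hom (Ω n) H)
  (g' : Hom G G') (h' : Hom H H') →
  let P  = 𝔓 g h
      P' = 𝔓 (g' ∘H g) (h' ∘H h)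
      Eqs : Hom P P' → Set
      Eqs u = (∀ x → fun u (𝔓₁ g h x) ≡ 𝔓₁ (g' ∘H g) (h' ∘H h) (fun g' x)) ×
              (∀ y → fun u (𝔓₂ g h y) ≡ 𝔓₂ (g' ∘H g) (h' ∘H h) (fun h' y))
  in Σ (Hom P P') λ u → Eqs u × (∀ (u' : Hom P P') → Eqs u' → ∀ p → fun u' p ≡ fun u p)

IsSpinedHGr : Set₁
IsSpinedHGr = 𝔓-cocone × SC1 × SC2

-- The glued vertex set is represented by canonical representatives: every
-- vertex of G, and the vertices of H outside the image of h₂.  Since the
-- spine maps are injective, each vertex of H is glued to at most one vertex
-- of G, which makes both inclusions injective; hyperedges are images, so
-- the inclusions preserve them by construction.  The mediating map of SC2
-- sends a representative to the class of its image under g' ⊎ h'; it is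
-- unique because the two inclusions are jointly surjective.
module Submission where

open import Defs
open import Data.Nat using (ℕ)
open import Data.Fin using (Fin)
open import Data.Fin.Properties using (any?)
import Data.Fin.Properties as FinP
open import Data.Bool using (Bool; not; T)
open import Data.Bool.Properties using (T?; T-irrelevant)
open import Data.Unit using (tt)
open import Data.Empty using (⊥-elim)
open import Data.Sum using (_⊎_; inj₁; inj₂)
import Data.Sum as Sum
open import Data.Sum.Properties using (inj₁-injective; inj₂-injective)
open import Data.Product using (∃-syntax; _×_; _,_; proj₁; proj₂)
open import Function using (_∘_)
open import Function.Bundles using (mk⇔; Equivalence)
open import Function.Definitions using (Injective)
open import Relation.Nullary using (Dec; yes; no; ¬_)
open import Relation.Nullary.Decidable using (⌊_⌋; toWitness; fromWitness; _×-dec_)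
open import Relation.Binary.Definitions using (DecidableEquality)
open import Relation.Binary.PropositionalEquality using (_≡_; refl; sym; trans; cong)

open Equivalence using (to; from)

image-exists : (H : Hypergraph) {B : Set} → DecidableEquality B →
  (f : V H → B) (F : V H → Bool) → ∃[ S ] IsImage f F S
image-exists H _≟_ f F = (λ w → ⌊ hit? w ⌋) , λ w → mk⇔ (hit→ w) (→hit w)
  where
  hit? : ∀ w → Dec (∃[ i ] (T (F (enum H i)) × f (enum H i) ≡ w))
  hit? w = any? (λ i → T? (F (enum H i)) ×-dec (f (enum H i) ≟ w))
  hit→ : ∀ w → T ⌊ hit? w ⌋ → ∃[ v ] (T (F v) × f v ≡ w)
  hit→ w t with toWitness t
  ... | i , Fv , fv≡w = enum H i , Fv , fv≡w
  →hit : ∀ w → ∃[ v ] (T (F v) × f v ≡ w) → T ⌊ hit? w ⌋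
  →hit w (v , Fv , fv≡w) with enum-surj H v
  ... | i , refl = fromWitness (i , Fv , fv≡w)

module _ {A B C : Set} {f : A → B} {g : B → C}
         {F : A → Bool} {S : B → Bool} {K : C → Bool} where

  IsImage-∘ : IsImage f F S → IsImage g S K → IsImage (g ∘ f) F K
  IsImage-∘ imS imK w = mk⇔ into onto
    where
    into : T (K w) → ∃[ v ] (T (F v) × g (f v) ≡ w)
    into Kw with to (imK w) Kw
    ... | u , Su , gu≡w with to (imS u) Su
    ...   | v , Fv , fv≡u = v , Fv , trans (cong g fv≡u) gu≡w
    onto : ∃[ v ] (T (F v) × g (f v) ≡ w) → T (K w)
    onto (v , Fv , gfv≡w) = from (imK w) (f v , from (imS (f v)) (v , Fv , refl) , gfv≡w)

  IsImage-cancel : IsImage f F S → IsImage (g ∘ f) F K → IsImage g S K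
  IsImage-cancel imS imK w = mk⇔ into onto
    where
    into : T (K w) → ∃[ u ] (T (S u) × g u ≡ w)
    into Kw with to (imK w) Kw
    ... | v , Fv , gfv≡w = f v , from (imS (f v)) (v , Fv , refl) , gfv≡w
    onto : ∃[ u ] (T (S u) × g u ≡ w) → T (K w)
    onto (u , Su , gu≡w) with to (imS u) Su
    ... | v , Fv , fv≡u = from (imK w) (v , Fv , trans (cong g fv≡u) gu≡w)

IsImage-cong : {A B : Set} {f f' : A → B} {F : A → Bool} {S : B → Bool} →
  (∀ a → f a ≡ f' a) → IsImage f F S → IsImage f' F S
IsImage-cong f≗f' im w = mk⇔
  (λ Sw → let (v , Fv , fv≡w) = to (im w) Sw in v , Fv , trans (sym (f≗f' v)) fv≡w)
  (λ { (v , Fv , f'v≡w) → from (im w) (v , Fv , trans (f≗f' v) f'v≡w) })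

⊎-map-injective : {A B A' B' : Set} {f : A → A'} {g : B → B'} →
  Injective _≡_ _≡_ f → Injective _≡_ _≡_ g → Injective _≡_ _≡_ (Sum.map f g)
⊎-map-injective f-inj g-inj {inj₁ _} {inj₁ _} eq = cong inj₁ (f-inj (inj₁-injective eq))
⊎-map-injective f-inj g-inj {inj₂ _} {inj₂ _} eq = cong inj₂ (g-inj (inj₂-injective eq))
⊎-map-injective f-inj g-inj {inj₁ _} {inj₂ _} ()
⊎-map-injective f-inj g-inj {inj₂ _} {inj₁ _} ()

module GluingProperties {n : ℕ} (G H : Hypergraph) (h₁ : Fin n → V G) (h₂ : Fin n → V H)
  (h₁-inj : Injective _≡_ _≡_ h₁) (h₂-inj : Injective _≡_ _≡_ h₂) where

  open Gluing G H h₁ h₂ public renaming (𝔓 to Glued)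

  PV-≡ : {p q : PV} → proj₁ p ≡ proj₁ q → p ≡ q
  PV-≡ {z , s} {.z , t} refl = cong (z ,_) (T-irrelevant s t)

  canonical⇒∉im₂ : ∀ y → T (not ⌊ inIm₂ y ⌋) → ¬ (∃[ j ] h₂ j ≡ y)
  canonical⇒∉im₂ y t y∈im with inIm₂ y
  ... | yes _ = t
  ... | no y∉im = y∉im y∈im

  ι₂-Case : V H → Set
  ι₂-Case y = (∃[ j ] (h₂ j ≡ y × ι₂ y ≡ ι₁ (h₁ j)))
            ⊎ (¬ (∃[ j ] h₂ j ≡ y) × proj₁ (ι₂ y) ≡ inj₂ y)

  pattern glued j h₂j≡y ι₂y≡ι₁h₁j = inj₁ (j , h₂j≡y , ι₂y≡ι₁h₁j)
  pattern kept y∉im label = inj₂ (y∉im , label)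

  ι₂-case : ∀ y → ι₂-Case y
  ι₂-case y with inIm₂ y
  ... | yes (j , h₂j≡y) = glued j h₂j≡y refl
  ... | no y∉im         = kept y∉im refl

  ι-jointly-surjective : ∀ p → (∃[ x ] ι₁ x ≡ p) ⊎ (∃[ y ] ι₂ y ≡ p)
  ι-jointly-surjective (inj₁ x , _) = inj₁ (x , refl)
  ι-jointly-surjective (inj₂ y , t) with ι₂-case y
  ... | glued j h₂j≡y _ = ⊥-elim (canonical⇒∉im₂ y t (j , h₂j≡y))
  ... | kept _ label    = inj₂ (y , PV-≡ label)

  ι-commute : ∀ i → ι₁ (h₁ i) ≡ ι₂ (h₂ i)
  ι-commute i with ι₂-case (h₂ i)
  ... | glued j h₂j≡h₂i ι₂≡ι₁ rewrite h₂-inj h₂j≡h₂i = sym ι₂≡ι₁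
  ... | kept h₂i∉im _ = ⊥-elim (h₂i∉im (i , refl))

  ι₁-injective : Injective _≡_ _≡_ ι₁
  ι₁-injective = inj₁-injective ∘ cong proj₁

  ι₂-injective : Injective _≡_ _≡_ ι₂
  ι₂-injective {y} {y'} ι₂y≡ι₂y' with ι₂-case y | ι₂-case y'
  ... | glued i h₂i≡y ι₂y≡ | glued j h₂j≡y' ι₂y'≡ =
    trans (sym h₂i≡y) (trans (cong h₂ (h₁-inj (ι₁-injective ι₁≡ι₁))) h₂j≡y')
    where ι₁≡ι₁ = trans (sym ι₂y≡) (trans ι₂y≡ι₂y' ι₂y'≡)
  ... | glued _ _ ι₂y≡ | kept _ label' with trans (cong proj₁ (trans (sym ι₂y≡) ι₂y≡ι₂y')) label'
  ...   | ()
  ι₂-injective ι₂y≡ι₂y' | kept _ label | glued _ _ ι₂y'≡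
    with trans (cong proj₁ (trans (sym ι₂y'≡) (sym ι₂y≡ι₂y'))) label
  ... | ()
  ι₂-injective ι₂y≡ι₂y' | kept _ label | kept _ label' =
    inj₂-injective (trans (sym label) (trans (cong proj₁ ι₂y≡ι₂y') label'))

  ι₁-preserves : Preserves G Glued ι₁
  ι₁-preserves F eF = let (S , im) = image-exists G (_≟V_ Glued) ι₁ F in S , inj₁ (F , eF , im) , im

  ι₂-preserves : Preserves H Glued ι₂
  ι₂-preserves F eF = let (S , im) = image-exists H (_≟V_ Glued) ι₂ F in S , inj₂ (F , eF , im) , im

module GluingOf {n : ℕ} {G H : Hypergraph} (g : Hom (Ω n) G) (h : Hom (Ω n) H) =
  GluingProperties G H (fun g) (fun h) (proj₁ (isHom g)) (proj₁ (isHom h))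

cocone : 𝔓-cocone
cocone g h = (ι₁-injective , ι₁-preserves) , (ι₂-injective , ι₂-preserves) , ι-commute
  where open GluingOf g h

sc1 : SC1
sc1 X = size X , hom index (index-injective , index-preserves)
  where
  index : V X → Fin (size X)
  index v = proj₁ (enum-surj X v)
  index-injective : Injective _≡_ _≡_ index
  index-injective {x} {y} eq =
    trans (sym (proj₂ (enum-surj X x))) (trans (cong (enum X) eq) (proj₂ (enum-surj X y)))
  index-preserves : Preserves X (Ω (size X)) index
  index-preserves F _ = let (S , im) = image-exists X FinP._≟_ index F in S , tt , im

module Mediating {n : ℕ} {G H G' H' : Hypergraph} (g : Hom (Ω n) G) (h : Hom (Ω n) H)
  (g' : Hom G G') (h' : Hom H H') where

  module P  = GluingOf g h
  module P' = GluingOf (g' ∘H g) (h' ∘H h)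

  mediate₀ : V G ⊎ V H → P'.PV
  mediate₀ (inj₁ x) = P'.ι₁ (fun g' x)
  mediate₀ (inj₂ y) = P'.ι₂ (fun h' y)

  mediate : P.PV → P'.PV
  mediate = mediate₀ ∘ proj₁

  mediate-ι₁ : ∀ x → mediate (P.ι₁ x) ≡ P'.ι₁ (fun g' x)
  mediate-ι₁ x = refl

  mediate-ι₂ : ∀ y → mediate (P.ι₂ y) ≡ P'.ι₂ (fun h' y)
  mediate-ι₂ y with P.ι₂-case y
  ... | P.glued j refl ι₂y≡ι₁h₁j = trans (cong mediate ι₂y≡ι₁h₁j) (P'.ι-commute j)
  ... | P.kept _ label = cong mediate₀ label

  -- A representative inj₂ y is not glued, so neither is inj₂ (h' y).
  mediate-label : ∀ p → proj₁ (mediate p) ≡ Sum.map (fun g') (fun h') (proj₁ p)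
  mediate-label (inj₁ x , _) = refl
  mediate-label (inj₂ y , t) with P'.ι₂-case (fun h' y)
  ... | P'.glued j h'h₂j≡h'y _ =
    ⊥-elim (P.canonical⇒∉im₂ y t (j , proj₁ (isHom h') h'h₂j≡h'y))
  ... | P'.kept _ label = label

  mediate-injective : Injective _≡_ _≡_ mediate
  mediate-injective {p} {q} eq = P.PV-≡
    (⊎-map-injective (proj₁ (isHom g')) (proj₁ (isHom h'))
      (trans (sym (mediate-label p)) (trans (cong proj₁ eq) (mediate-label q))))

  mediate-preserves : Preserves P.Glued P'.Glued mediate
  mediate-preserves S (inj₁ (F , eF , imS)) =
    let (F' , eF' , imF') = proj₂ (isHom g') F eF
        (S' , eS' , imS') = P'.ι₁-preserves F' eF'
    in S' , eS' , IsImage-cancel imS (IsImage-cong (sym ∘ mediate-ι₁) (IsImage-∘ imF' imS'))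
  mediate-preserves S (inj₂ (F , eF , imS)) =
    let (F' , eF' , imF') = proj₂ (isHom h') F eF
        (S' , eS' , imS') = P'.ι₂-preserves F' eF'
    in S' , eS' , IsImage-cancel imS (IsImage-cong (sym ∘ mediate-ι₂) (IsImage-∘ imF' imS'))

  mediator : Hom P.Glued P'.Glued
  mediator = hom mediate (mediate-injective , mediate-preserves)

  mediator-unique : (u : Hom P.Glued P'.Glued) →
    (∀ x → fun u (P.ι₁ x) ≡ P'.ι₁ (fun g' x)) → (∀ y → fun u (P.ι₂ y) ≡ P'.ι₂ (fun h' y)) →
    ∀ p → fun u p ≡ mediate p
  mediator-unique u u-ι₁ u-ι₂ p with P.ι-jointly-surjective p
  ... | inj₁ (x , refl) = trans (u-ι₁ x) (sym (mediate-ι₁ x))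
  ... | inj₂ (y , refl) = trans (u-ι₂ y) (sym (mediate-ι₂ y))

sc2 : SC2
sc2 g h g' h' = mediator , (mediate-ι₁ , mediate-ι₂) , λ u (u-ι₁ , u-ι₂) → mediator-unique u u-ι₁ u-ι₂
  where open Mediating g h g' h'

theorem5p2 : IsSpinedHGr
theorem5p2 = cocone , sc1 , sc2
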